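{- Let $n$ and $k$ be integers with $2\le k\le n-1$ and $k\le n/2+1$. Then \[\binom{n}{2}-t(n,k-1)\le f(n,k)\le \binom{n}{2}-t(n,k-1)+(k-1).\]
   Context: A directed 3-hypergraph $H=(V,F)$ consists of hyperarcs $u,v\to w$ (body $\{u,v\}$ of two distinct vertices, head $w$). The closure of $S\subseteq V$ is obtained by forward chaining: mark $S$; while some hyperarc $a,b\to c$ has $a,b$ marked and $c$ unmarked, mark $c$. $f(n,k)$ is the minimum number of hyperarcs in a directed 3-hypergraph on $n$ vertices such that the closure of every $k$-element subset of the vertices is the whole vertex set. The Turán graph $T(n,k-1)$ is the complete $(k-1)$-partite graph on $n$ vertices with parts of sizes $\lfloor n/(k-1)\rfloor$ or $\lceil n/(k-1)\rceil$, and $t(n,k-1)$ is its number of edges. -}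

module Defs where

open import Data.Nat using (ℕ; zero; suc; _+_; _*_; _∸_; _≤_; _<_; NonZero)
open import Data.Nat.DivMod using (_%_)
open import Data.Nat.Combinatorics using (_C_)
open import Data.Fin using (Fin; toℕ) renaming (_<_ to _<ᶠ_)
open import Data.Fin.Subset using (Subset; _∈_; ∣_∣)
open import Data.List using (List; length; filter; allFin; concatMap; map)
open import Data.List.Membership.Propositional using () renaming (_∈_ to _∈ˡ_)
open import Data.List.Relation.Unary.Unique.Propositional using (Unique)
open import Data.Product using (_×_; _,_; Σ; ∃)
open import Relation.Binary.PropositionalEquality using (_≡_; _≢_)
open import Relation.Nullary using (¬_)
open import Data.Nat using (_≟_)
open import Relation.Nullary.Decidable using (¬?)

-- A hyperarc u,v → w on vertex set Fin n. The body {u,v} is an unordered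
-- pair of distinct vertices, stored canonically with u < v; the head w is
-- not in the body.
record Hyperarc (n : ℕ) : Set where
  constructor arc
  field
    u v w : Fin n
    u<v   : u <ᶠ v
    w≢u   : w ≢ u
    w≢v   : w ≢ v

open Hyperarc public

record Hypergraph (n : ℕ) : Set where
  constructor hg
  field
    arcs   : List (Hyperarc n)
    unique : Unique arcs

open Hypergraph public

size : ∀ {n} → Hypergraph n → ℕ
size H = length (arcs H)

data InClosure {n : ℕ} (H : Hypergraph n) (S : Subset n) : Fin n → Set where
  base : ∀ {x} → x ∈ S → InClosure H S x
  step : ∀ (a : Hyperarc n) → a ∈ˡ arcs H →
         InClosure H S (u a) → InClosure H S (v a) → InClosure H S (w a)

Good : ∀ {n} → ℕ → Hypergraph n → Set
Good {n} k H = ∀ (S : Subset n) → ∣ S ∣ ≡ k → ∀ (x : Fin n) → InClosure H S x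

-- Number of edges of the Turán graph T(n,r) (r ≥ 1): vertices 0..n-1,
-- vertex i lies in part (i mod r), giving r parts of sizes ⌊n/r⌋ or ⌈n/r⌉;
-- edges are pairs i < j lying in different parts.
turan : ℕ → ℕ → ℕ
turan n zero = 0
turan n (suc r) =
  length (filter (λ p → ¬? (Data.Product.proj₁ p % suc r ≟ Data.Product.proj₂ p % suc r))
    (concatMap (λ j → map (λ i → (toℕ i , toℕ j)) (allFin (toℕ j))) (allFin n)))

-- Lower bound: a set S of k < n vertices containing no body {u, v} of a hyperarc is its own
-- closure, so in a good hypergraph the graph of bodies has no independent k-set.  By Turán's theorem
-- it then has at least C(n,2) − t(n, k−1) edges; this is proved by repeatedly deleting a vertex of
-- large degree, and when every degree is small a greedy independent set of size k appears.
-- Upper bound: split the vertices into the k − 1 residue classes mod k − 1 and put one hyperarc on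
-- each of the C(n,2) − t(n, k−1) pairs inside a class.  The heads are chosen so that the closure of
-- two vertices of a class contains the whole class, unless they are its last two vertices, which
-- give the first vertex of the next class instead; k − 1 extra hyperarcs, one per class, then give
-- the second vertex of the next class, so the closure of a class passes on to the next.  Any k
-- vertices contain two in the same class, so their closure goes round all classes.

module Submission where

open import Defs
open import Data.Nat using (ℕ; zero; suc; _+_; _*_; _∸_; _≤_; _<_; z≤n; s≤s; s≤s⁻¹; _≟_; _<?_; _≤?_)
open import Data.Nat.Properties
open import Data.Nat.DivMod using (_%_; _/_; m%n%n≡m%n; n%1≡0; m<n⇒m%n≡m; [m+kn]%n≡m%n; m≡m%n+[m/n]*n; m%n<n; [m+n]%n≡m%n; n%n≡0; %-distribˡ-+)
open import Data.Nat.Combinatorics using (_C_; nC1≡n; nCk+nC[k+1]≡[n+1]C[k+1])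
open import Data.Nat.Induction using (<-rec)
open import Data.Nat.Tactic.RingSolver using (solve-∀)
open import Data.Bool using (Bool; true; false; _∧_; _∨_; not; if_then_else_)
import Data.Bool.Properties as BP
open import Data.Bool.Properties using (∧-zeroʳ; ∧-identityʳ; ∨-identityʳ; ∨-zeroʳ; ∧-distribˡ-∨; ¬-not; ∧-conicalˡ; ∧-conicalʳ)
open import Algebra.Properties.CommutativeSemigroup +-commutativeSemigroup using () renaming (interchange to +-interchange)
open import Data.Fin using (Fin; zero; suc; toℕ; fromℕ<)
import Data.Fin.Properties as FP
open import Data.Fin.Properties using (toℕ-fromℕ<; toℕ-injective; toℕ<n)
open import Data.Fin.Subset using (Subset; ∣_∣)
open import Data.Vec using (tabulate; lookup)
open import Data.Vec.Properties using (lookup∘tabulate; []=⇒lookup; tabulate∘lookup; lookup⇒[]=)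
open import Data.Product using (Σ; _×_; _,_; proj₁; proj₂)
open import Data.Sum using (_⊎_; inj₁; inj₂)
open import Data.Empty using (⊥; ⊥-elim)
open import Data.List using (List; []; _∷_; _++_; length; [_]; filter; allFin; concatMap; map)
import Data.List as List
open import Data.List.Properties using (length-++)
open import Data.List.Relation.Unary.Any using (here; there)
open import Data.List.Membership.Propositional using () renaming (_∈_ to _∈ˡ_)
open import Data.List.Membership.Propositional.Properties using (∈-++⁺ˡ; ∈-++⁺ʳ; ∈-++⁻)
open import Data.List.Relation.Unary.Unique.Propositional using (Unique)
import Data.List.Relation.Unary.Unique.Propositional.Properties as UP
open import Data.List.Relation.Unary.AllPairs using ([]; _∷_)
open import Data.List.Relation.Unary.All using ([]; _∷_)
open import Relation.Binary.PropositionalEquality hiding ([_])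
open import Relation.Binary.Definitions using (tri<; tri≈; tri>)
open import Relation.Nullary using (¬_; yes; no; does; Dec)
open import Relation.Nullary.Decidable using (¬?; dec-true; dec-false; _×-dec_)
open import Relation.Unary using (Pred; Decidable)
open import Function using (_∘_)

indicator : Bool → ℕ
indicator true  = 1
indicator false = 0

count : ∀ {n} → (Fin n → Bool) → ℕ
count {zero}  p = 0
count {suc n} p = indicator (p zero) + count (p ∘ suc)

infix 4 _⊆ᵇ_

_⊆ᵇ_ : ∀ {n} → (Fin n → Bool) → (Fin n → Bool) → Set
P ⊆ᵇ Q = ∀ y → P y ≡ true → Q y ≡ true

true≢false : true ≢ false
true≢false ()

does≡true⇒ : ∀ {P : Set} (d : Dec P) → does d ≡ true → P
does≡true⇒ (yes p) _ = p

∨-≡true : ∀ a b → a ∨ b ≡ true → a ≡ true ⊎ b ≡ true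
∨-≡true true  b _ = inj₁ refl
∨-≡true false b e = inj₂ e

count-cong : ∀ {n} (f g : Fin n → Bool) → (∀ x → f x ≡ g x) → count f ≡ count g
count-cong {zero}  f g e = refl
count-cong {suc n} f g e = cong₂ _+_ (cong indicator (e zero)) (count-cong (f ∘ suc) (g ∘ suc) (e ∘ suc))

indicator-split : ∀ a b → indicator a ≡ indicator (a ∧ b) + indicator (a ∧ not b)
indicator-split true  true  = refl
indicator-split true  false = refl
indicator-split false b     = refl

count-split : ∀ {n} (f g : Fin n → Bool) →
              count f ≡ count (λ x → f x ∧ g x) + count (λ x → f x ∧ not (g x))
count-split {zero}  f g = refl
count-split {suc n} f g =
  trans (cong₂ _+_ (indicator-split (f zero) (g zero)) (count-split (f ∘ suc) (g ∘ suc)))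
        (+-interchange (indicator (f zero ∧ g zero)) (indicator (f zero ∧ not (g zero))) _ _)

indicator-mono : ∀ a b → (a ≡ true → b ≡ true) → indicator a ≤ indicator b
indicator-mono true  b h rewrite h refl = ≤-refl
indicator-mono false b h = z≤n

count-mono : ∀ {n} (f g : Fin n → Bool) → f ⊆ᵇ g → count f ≤ count g
count-mono {zero}  f g h = z≤n
count-mono {suc n} f g h = +-mono-≤ (indicator-mono _ _ (h zero)) (count-mono (f ∘ suc) (g ∘ suc) (h ∘ suc))

indicator-∨ : ∀ a b → indicator (a ∨ b) ≤ indicator a + indicator b
indicator-∨ true  b = s≤s z≤n
indicator-∨ false b = ≤-refl

count-∨ : ∀ {n} (f g : Fin n → Bool) → count (λ x → f x ∨ g x) ≤ count f + count g
count-∨ {zero}  f g = z≤n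
count-∨ {suc n} f g =
  ≤-trans (+-mono-≤ (indicator-∨ (f zero) (g zero)) (count-∨ (f ∘ suc) (g ∘ suc)))
          (≤-reflexive (+-interchange (indicator (f zero)) (indicator (g zero)) _ _))

count≡0 : ∀ {n} (f : Fin n → Bool) → (∀ x → f x ≡ false) → count f ≡ 0
count≡0 {zero}  f h = refl
count≡0 {suc n} f h rewrite h zero = count≡0 (f ∘ suc) (h ∘ suc)

count-true : ∀ n → count {n} (λ _ → true) ≡ n
count-true zero    = refl
count-true (suc n) = cong suc (count-true n)

count>0⇒∃true : ∀ {n} (f : Fin n → Bool) → 0 < count f → Σ (Fin n) λ x → f x ≡ true
count>0⇒∃true {suc n} f h with f zero in eq
... | true  = zero , eq
... | false with count>0⇒∃true (f ∘ suc) h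
...   | x , e = suc x , e

count<n⇒∃false : ∀ {n} (f : Fin n → Bool) → count f < n → Σ (Fin n) λ x → f x ≡ false
count<n⇒∃false {suc n} f h with f zero in eq
... | false = zero , eq
... | true with count<n⇒∃false (f ∘ suc) (s≤s⁻¹ h)
...   | x , e = suc x , e

infix 4 _==_

_==_ : ∀ {n} → Fin n → Fin n → Bool
zero  == zero  = true
zero  == suc y = false
suc x == zero  = false
suc x == suc y = x == y

==-refl : ∀ {n} (x : Fin n) → (x == x) ≡ true
==-refl zero    = refl
==-refl (suc x) = ==-refl x

==⇒≡ : ∀ {n} (x y : Fin n) → (x == y) ≡ true → x ≡ y
==⇒≡ zero    zero    e = refl
==⇒≡ (suc x) (suc y) e = cong suc (==⇒≡ x y e)

==-sym : ∀ {n} (x y : Fin n) → (x == y) ≡ (y == x)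
==-sym zero    zero    = refl
==-sym zero    (suc y) = refl
==-sym (suc x) zero    = refl
==-sym (suc x) (suc y) = ==-sym x y

count-∧== : ∀ {n} (f : Fin n → Bool) (z : Fin n) → count (λ y → f y ∧ (y == z)) ≡ indicator (f z)
count-∧== {suc n} f zero rewrite count≡0 (λ y → f (suc y) ∧ (suc y == zero)) (λ y → ∧-zeroʳ (f (suc y)))
  with f zero
... | true  = refl
... | false = refl
count-∧== {suc n} f (suc z) with f zero
... | true  = count-∧== (f ∘ suc) z
... | false = count-∧== (f ∘ suc) z

without : ∀ {n} → (Fin n → Bool) → Fin n → (Fin n → Bool)
without X x y = X y ∧ not (y == x)

without⊆ : ∀ {n} (X : Fin n → Bool) x → without X x ⊆ᵇ X
without⊆ X x y h with X y
... | true = refl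

count-without : ∀ {n} (X : Fin n → Bool) x → X x ≡ true → count X ≡ suc (count (without X x))
count-without X x Xx = begin
  count X                                                     ≡⟨ count-split X (_== x) ⟩
  count (λ y → X y ∧ (y == x)) + count (without X x)          ≡⟨ cong (_+ count (without X x)) (count-∧== X x) ⟩
  indicator (X x) + count (without X x)                       ≡⟨ cong (λ b → indicator b + count (without X x)) Xx ⟩
  suc (count (without X x))                                   ∎
  where open ≡-Reasoning

count-insert : ∀ {n} (S : Fin n → Bool) x → S x ≡ false → count (λ y → S y ∨ (y == x)) ≡ suc (count S)
count-insert S x Sx =
  trans (count-without S∪x x (trans (cong (S x ∨_) (==-refl x)) (∨-zeroʳ (S x))))
        (cong suc (count-cong _ _ removeInserted))
  where
  S∪x : _ → Bool
  S∪x y = S y ∨ (y == x)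
  removeInserted : ∀ y → without S∪x x y ≡ S y
  removeInserted y with y == x in e
  ... | true  = trans (∧-zeroʳ _) (sym (subst (λ z → S z ≡ false) (sym (==⇒≡ y x e)) Sx))
  ... | false = trans (∧-identityʳ _) (∨-identityʳ (S y))

countL : ∀ {A : Set} → (A → Bool) → List A → ℕ
countL p []       = 0
countL p (x ∷ xs) = indicator (p x) + countL p xs

countL-cong : ∀ {A : Set} (p q : A → Bool) (xs : List A) → (∀ x → p x ≡ q x) → countL p xs ≡ countL q xs
countL-cong p q []       e = refl
countL-cong p q (x ∷ xs) e = cong₂ _+_ (cong indicator (e x)) (countL-cong p q xs e)

countL-split : ∀ {A : Set} (p q : A → Bool) (xs : List A) →
               countL p xs ≡ countL (λ x → p x ∧ not (q x)) xs + countL (λ x → p x ∧ q x) xs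
countL-split p q []       = refl
countL-split p q (x ∷ xs) =
  trans (cong₂ _+_ (trans (indicator-split (p x) (q x)) (+-comm (indicator (p x ∧ q x)) _)) (countL-split p q xs))
        (+-interchange (indicator (p x ∧ not (q x))) (indicator (p x ∧ q x)) _ _)

countL-true : ∀ {A : Set} (xs : List A) → countL (λ _ → true) xs ≡ length xs
countL-true []       = refl
countL-true (x ∷ xs) = cong suc (countL-true xs)

sumTo : ℕ → (ℕ → ℕ) → ℕ
sumTo zero h = 0
sumTo (suc n) h = h 0 + sumTo n (h ∘ suc)

sumTo-suc : ∀ n h → sumTo (suc n) h ≡ sumTo n h + h n
sumTo-suc zero h = +-comm (h 0) 0
sumTo-suc (suc n) h = trans (cong (h 0 +_) (sumTo-suc n (h ∘ suc))) (sym (+-assoc (h 0) _ _))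

sumTo-cong : ∀ n h g → (∀ i → i < n → h i ≡ g i) → sumTo n h ≡ sumTo n g
sumTo-cong zero h g e = refl
sumTo-cong (suc n) h g e =
  cong₂ _+_ (e 0 (s≤s z≤n)) (sumTo-cong n (h ∘ suc) (g ∘ suc) (λ i lt → e (suc i) (s≤s lt)))

sumTo-+ : ∀ a b h → sumTo (a + b) h ≡ sumTo a h + sumTo b (λ i → h (a + i))
sumTo-+ zero b h = refl
sumTo-+ (suc a) b h = trans (cong (h 0 +_) (sumTo-+ a b (h ∘ suc))) (sym (+-assoc (h 0) _ _))

sumTo≡0 : ∀ n h → (∀ i → i < n → h i ≡ 0) → sumTo n h ≡ 0
sumTo≡0 zero    h e = refl
sumTo≡0 (suc n) h e = cong₂ _+_ (e 0 (s≤s z≤n)) (sumTo≡0 n (h ∘ suc) (λ i lt → e (suc i) (s≤s lt)))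

sumTo-1 : ∀ n → sumTo n (λ _ → 1) ≡ n
sumTo-1 zero = refl
sumTo-1 (suc n) = cong suc (sumTo-1 n)

sumTo-id : ∀ n → sumTo n (λ i → i) ≡ n C 2
sumTo-id zero = refl
sumTo-id (suc n) = begin
  sumTo (suc n) (λ i → i)  ≡⟨ sumTo-suc n (λ i → i) ⟩
  sumTo n (λ i → i) + n    ≡⟨ +-comm _ n ⟩
  n + sumTo n (λ i → i)    ≡⟨ cong₂ _+_ (sym (nC1≡n n)) (sumTo-id n) ⟩
  n C 1 + n C 2            ≡⟨ nCk+nC[k+1]≡[n+1]C[k+1] n 1 ⟩
  suc n C 2                ∎
  where open ≡-Reasoning

-- The shadow graph: x and y are adjacent when {x, y} is the body of a hyperarc

u≢v : ∀ {n} (a : Hyperarc n) → u a ≢ v a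
u≢v a = FP.<⇒≢ (u<v a)

bothIn : ∀ {n} → (Fin n → Bool) → Hyperarc n → Bool
bothIn X a = X (u a) ∧ X (v a)

incident : ∀ {n} → Fin n → Hyperarc n → Bool
incident x a = (u a == x) ∨ (v a == x)

module _ {n : ℕ} (A : List (Hyperarc n)) where

  edgesWithin : (Fin n → Bool) → ℕ
  edgesWithin X = countL (bothIn X) A

  degreeIn : Fin n → (Fin n → Bool) → ℕ
  degreeIn x X = countL (λ a → bothIn X a ∧ incident x a) A

  Independent : (Fin n → Bool) → Set
  Independent S = ∀ a → a ∈ˡ A → S (u a) ≡ true → S (v a) ≡ true → ⊥

  NoIndependentSet : ℕ → (Fin n → Bool) → Set
  NoIndependentSet k X = ∀ S → S ⊆ᵇ X → count S ≡ k → Independent S → ⊥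

adjacentVia : ∀ {n} → Hyperarc n → Fin n → Fin n → Bool
adjacentVia a x y = ((u a == x) ∧ (v a == y)) ∨ ((v a == x) ∧ (u a == y))

adjacent : ∀ {n} → List (Hyperarc n) → Fin n → Fin n → Bool
adjacent []       x y = false
adjacent (a ∷ as) x y = adjacentVia a x y ∨ adjacent as x y

adjacent-uv : ∀ {n} (A : List (Hyperarc n)) a → a ∈ˡ A → adjacent A (u a) (v a) ≡ true
adjacent-uv (a ∷ as) a (here refl) rewrite ==-refl (u a) | ==-refl (v a) = refl
adjacent-uv (b ∷ as) a (there m) rewrite adjacent-uv as a m = ∨-zeroʳ _

adjacent-vu : ∀ {n} (A : List (Hyperarc n)) a → a ∈ˡ A → adjacent A (v a) (u a) ≡ true
adjacent-vu (a ∷ as) a (here refl)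
  rewrite ==-refl (u a) | ==-refl (v a) | ∨-zeroʳ ((u a == v a) ∧ (v a == u a)) = refl
adjacent-vu (b ∷ as) a (there m) rewrite adjacent-vu as a m = ∨-zeroʳ _

neighboursVia≤ : ∀ {n} (X : Fin n → Bool) (x : Fin n) → X x ≡ true → (a : Hyperarc n) →
                 count (λ y → X y ∧ adjacentVia a x y) ≤ indicator (bothIn X a ∧ incident x a)
neighboursVia≤ X x Xx a with u a == x in e1 | v a == x in e2
... | true | true = ⊥-elim (u≢v a (trans (==⇒≡ _ _ e1) (sym (==⇒≡ _ _ e2))))
... | true | false =
  ≤-reflexive (trans (count-cong _ _ (λ y → cong (X y ∧_) (trans (∨-identityʳ _) (==-sym (v a) y))))
              (trans (count-∧== X (v a)) (cong indicator (sym (trans (∧-identityʳ _) (cong (_∧ X (v a)) Xu))))))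
  where Xu : X (u a) ≡ true
        Xu = subst (λ z → X z ≡ true) (sym (==⇒≡ _ _ e1)) Xx
... | false | true =
  ≤-reflexive (trans (count-cong _ _ (λ y → cong (X y ∧_) (==-sym (u a) y)))
              (trans (count-∧== X (u a))
                     (cong indicator (sym (trans (∧-identityʳ _) (trans (cong (X (u a) ∧_) Xv) (∧-identityʳ _)))))))
  where Xv : X (v a) ≡ true
        Xv = subst (λ z → X z ≡ true) (sym (==⇒≡ _ _ e2)) Xx
... | false | false = ≤-reflexive (trans (count≡0 _ (λ y → ∧-zeroʳ (X y))) (cong indicator (sym (∧-zeroʳ _))))

neighbours≤degree : ∀ {n} (A : List (Hyperarc n)) (X : Fin n → Bool) (x : Fin n) → X x ≡ true →
                    count (λ y → X y ∧ adjacent A x y) ≤ degreeIn A x X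
neighbours≤degree []       X x Xx = ≤-reflexive (count≡0 _ (λ y → ∧-zeroʳ (X y)))
neighbours≤degree (a ∷ as) X x Xx = begin
  count (λ y → X y ∧ adjacent (a ∷ as) x y)
    ≡⟨ count-cong _ _ (λ y → ∧-distribˡ-∨ (X y) (adjacentVia a x y) (adjacent as x y)) ⟩
  count (λ y → (X y ∧ adjacentVia a x y) ∨ (X y ∧ adjacent as x y))
    ≤⟨ count-∨ (λ y → X y ∧ adjacentVia a x y) (λ y → X y ∧ adjacent as x y) ⟩
  count (λ y → X y ∧ adjacentVia a x y) + count (λ y → X y ∧ adjacent as x y)
    ≤⟨ +-mono-≤ (neighboursVia≤ X x Xx a) (neighbours≤degree as X x Xx) ⟩
  degreeIn (a ∷ as) x X ∎
  where open ≤-Reasoning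

-- Independent sets in graphs of bounded degree, and Turán's bound

nonNeighbours : ∀ {n} → List (Hyperarc n) → (Fin n → Bool) → Fin n → (Fin n → Bool)
nonNeighbours A Y x y = Y y ∧ not ((y == x) ∨ adjacent A x y)

nonNeighbours-spec : ∀ {n} (A : List (Hyperarc n)) Y x y → nonNeighbours A Y x y ≡ true →
                     Y y ≡ true × (y == x) ≡ false × adjacent A x y ≡ false
nonNeighbours-spec A Y x y h with Y y | y == x | adjacent A x y
... | true | false | false = refl , refl , refl

closedNeighbourhood≤ : ∀ {n} (A : List (Hyperarc n)) X Y x → Y ⊆ᵇ X → Y x ≡ true →
                       count (λ y → Y y ∧ ((y == x) ∨ adjacent A x y)) ≤ suc (degreeIn A x X)
closedNeighbourhood≤ A X Y x Y⊆X Yx = begin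
  count (λ y → Y y ∧ ((y == x) ∨ adjacent A x y))
    ≡⟨ count-cong _ _ (λ y → ∧-distribˡ-∨ (Y y) (y == x) (adjacent A x y)) ⟩
  count (λ y → (Y y ∧ (y == x)) ∨ (Y y ∧ adjacent A x y))
    ≤⟨ count-∨ (λ y → Y y ∧ (y == x)) (λ y → Y y ∧ adjacent A x y) ⟩
  count (λ y → Y y ∧ (y == x)) + count (λ y → Y y ∧ adjacent A x y)
    ≤⟨ +-mono-≤ (≤-reflexive (trans (count-∧== Y x) (cong indicator Yx)))
                (≤-trans (count-mono _ _ restrict) (neighbours≤degree A X x (Y⊆X x Yx))) ⟩
  suc (degreeIn A x X) ∎
  where
  open ≤-Reasoning
  restrict : (λ y → Y y ∧ adjacent A x y) ⊆ᵇ (λ y → X y ∧ adjacent A x y)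
  restrict y h with Y y in eY
  ... | true rewrite Y⊆X y eY = h

insert-independent : ∀ {n} (A : List (Hyperarc n)) Y x S → Independent A S → S ⊆ᵇ nonNeighbours A Y x →
                     Independent A (λ y → S y ∨ (y == x))
insert-independent A Y x S indS S⊆ a a∈A hu hv with ∨-≡true (S (u a)) _ hu | ∨-≡true (S (v a)) _ hv
... | inj₁ Su  | inj₁ Sv  = indS a a∈A Su Sv
... | inj₂ u≡x | inj₂ v≡x = u≢v a (trans (==⇒≡ _ _ u≡x) (sym (==⇒≡ _ _ v≡x)))
... | inj₂ u≡x | inj₁ Sv  =
  notAdjacent (v a) Sv (subst (λ z → adjacent A z (v a) ≡ true) (==⇒≡ _ _ u≡x) (adjacent-uv A a a∈A))
  where
  notAdjacent : ∀ y → S y ≡ true → adjacent A x y ≡ true → ⊥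
  notAdjacent y Sy adj = true≢false (trans (sym adj) (proj₂ (proj₂ (nonNeighbours-spec A Y x y (S⊆ y Sy)))))
... | inj₁ Su  | inj₂ v≡x =
  notAdjacent (u a) Su (subst (λ z → adjacent A z (u a) ≡ true) (==⇒≡ _ _ v≡x) (adjacent-vu A a a∈A))
  where
  notAdjacent : ∀ y → S y ≡ true → adjacent A x y ≡ true → ⊥
  notAdjacent y Sy adj = true≢false (trans (sym adj) (proj₂ (proj₂ (nonNeighbours-spec A Y x y (S⊆ y Sy)))))

-- Choose x ∈ Y and recurse on the non-neighbours of x: each step discards fewer than D vertices.
greedyIndependent : ∀ {n} (A : List (Hyperarc n)) X D → (∀ x → X x ≡ true → suc (degreeIn A x X) ≤ D) →
                    ∀ j Y → Y ⊆ᵇ X → j * D < count Y →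
                    Σ (Fin n → Bool) λ S → S ⊆ᵇ Y × count S ≡ suc j × Independent A S
greedyIndependent A X D smallDegree zero Y Y⊆X 0<|Y| with count>0⇒∃true Y 0<|Y|
... | x , Yx =
  (_== x) , (λ y y≡x → subst (λ z → Y z ≡ true) (sym (==⇒≡ y x y≡x)) Yx) , count-∧== (λ _ → true) x ,
  λ a _ u≡x v≡x → u≢v a (trans (==⇒≡ _ _ u≡x) (sym (==⇒≡ _ _ v≡x)))
greedyIndependent A X D smallDegree (suc j) Y Y⊆X lt with count>0⇒∃true Y (≤-trans (s≤s z≤n) lt)
... | x , Yx with greedyIndependent A X D smallDegree j (nonNeighbours A Y x) Y'⊆X lt'
  where
  Y'⊆X : nonNeighbours A Y x ⊆ᵇ X
  Y'⊆X y = Y⊆X y ∘ proj₁ ∘ nonNeighbours-spec A Y x y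
  lt' : j * D < count (nonNeighbours A Y x)
  lt' = +-cancelˡ-< D (j * D) _ (begin-strict
    D + j * D                                                                     <⟨ lt ⟩
    count Y                                                                       ≡⟨ count-split Y _ ⟩
    count (λ y → Y y ∧ ((y == x) ∨ adjacent A x y)) + count (nonNeighbours A Y x)
      ≤⟨ +-monoˡ-≤ _ (≤-trans (closedNeighbourhood≤ A X Y x Y⊆X Yx) (smallDegree x (Y⊆X x Yx))) ⟩
    D + count (nonNeighbours A Y x)                                               ∎)
    where open ≤-Reasoning
... | S , S⊆Y' , |S| , indS =
  (λ y → S y ∨ (y == x)) , S∪x⊆Y , trans (count-insert S x x∉S) (cong suc |S|) ,
  insert-independent A Y x S indS S⊆Y'
  where
  x∉S : S x ≡ false
  x∉S = ¬-not λ Sx → true≢false (trans (sym (==-refl x)) (proj₁ (proj₂ (nonNeighbours-spec A Y x x (S⊆Y' x Sx)))))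
  S∪x⊆Y : (λ y → S y ∨ (y == x)) ⊆ᵇ Y
  S∪x⊆Y y h with ∨-≡true (S y) _ h
  ... | inj₁ Sy  = proj₁ (nonNeighbours-spec A Y x y (S⊆Y' y Sy))
  ... | inj₂ y≡x = subst (λ z → Y z ≡ true) (sym (==⇒≡ _ _ y≡x)) Yx

∧-not-∨-interchange : ∀ a b c d → (a ∧ b) ∧ not (c ∨ d) ≡ (a ∧ not c) ∧ (b ∧ not d)
∧-not-∨-interchange true  true  true  d     = refl
∧-not-∨-interchange true  true  false true  = refl
∧-not-∨-interchange true  true  false false = refl
∧-not-∨-interchange true  false c     d     = sym (∧-zeroʳ _)
∧-not-∨-interchange false b     c     d     = refl

edgesWithin-without : ∀ {n} (A : List (Hyperarc n)) X x →
                      edgesWithin A X ≡ edgesWithin A (without X x) + degreeIn A x X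
edgesWithin-without A X x =
  trans (countL-split (bothIn X) (incident x) A)
        (cong (_+ degreeIn A x X)
              (countL-cong _ _ A (λ a → ∧-not-∨-interchange (X (u a)) (X (v a)) (u a == x) (v a == x))))

-- Either some vertex has degree at least q N (delete it and recurse), or all degrees are
-- below q N and the greedy algorithm finds an independent set of size m + 1.
edgesWithin≥sumTo : ∀ {n} (A : List (Hyperarc n)) m (q : ℕ → ℕ) → (∀ N → m * q N ≤ N) →
                    ∀ N X → count X ≡ N → NoIndependentSet A (suc m) X → sumTo N q ≤ edgesWithin A X
edgesWithin≥sumTo A m q m*q≤ zero    X |X| noInd = z≤n
edgesWithin≥sumTo A m q m*q≤ (suc N) X |X| noInd
  with FP.any? (λ x → (X x BP.≟ true) ×-dec (q N ≤? degreeIn A x X))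
... | yes (x , Xx , q≤deg) = begin
  sumTo (suc N) q                                ≡⟨ sumTo-suc N q ⟩
  sumTo N q + q N                                ≤⟨ +-mono-≤ (edgesWithin≥sumTo A m q m*q≤ N (without X x) |X'| noInd') q≤deg ⟩
  edgesWithin A (without X x) + degreeIn A x X   ≡⟨ edgesWithin-without A X x ⟨
  edgesWithin A X                                ∎
  where
  open ≤-Reasoning
  |X'| : count (without X x) ≡ N
  |X'| = suc-injective (trans (sym (count-without X x Xx)) |X|)
  noInd' : NoIndependentSet A (suc m) (without X x)
  noInd' S S⊆X' = noInd S (λ y → without⊆ X x y ∘ S⊆X' y)
... | no ¬q≤deg
  with greedyIndependent A X (q N) smallDegree m X (λ _ h → h) (≤-trans (s≤s (m*q≤ N)) (≤-reflexive (sym |X|)))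
  where
  smallDegree : ∀ x → X x ≡ true → suc (degreeIn A x X) ≤ q N
  smallDegree x Xx = ≰⇒> (λ q≤deg → ¬q≤deg (x , Xx , q≤deg))
...   | S , S⊆X , |S| , indS = ⊥-elim (noInd S S⊆X |S| indS)

-- Turán's number as a sum over the vertices

length-filter : ∀ {A : Set} {ℓ} {P : Pred A ℓ} (P? : Decidable P) (xs : List A) →
                length (filter P? xs) ≡ countL (λ x → does (P? x)) xs
length-filter P? [] = refl
length-filter P? (x ∷ xs) with does (P? x)
... | true  = cong suc (length-filter P? xs)
... | false = length-filter P? xs

countL-++ : ∀ {A : Set} (p : A → Bool) xs ys → countL p (xs ++ ys) ≡ countL p xs + countL p ys
countL-++ p []       ys = refl
countL-++ p (x ∷ xs) ys = trans (cong (indicator (p x) +_) (countL-++ p xs ys)) (sym (+-assoc (indicator (p x)) _ _))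

countL-map : ∀ {A B : Set} (p : B → Bool) (g : A → B) xs → countL p (map g xs) ≡ countL (p ∘ g) xs
countL-map p g []       = refl
countL-map p g (x ∷ xs) = cong (indicator (p (g x)) +_) (countL-map p g xs)

sumL : ∀ {A : Set} → (A → ℕ) → List A → ℕ
sumL h []       = 0
sumL h (x ∷ xs) = h x + sumL h xs

sumL-cong : ∀ {A : Set} (xs : List A) {f g : A → ℕ} → (∀ x → f x ≡ g x) → sumL f xs ≡ sumL g xs
sumL-cong []       e = refl
sumL-cong (x ∷ xs) e = cong₂ _+_ (e x) (sumL-cong xs e)

countL-concatMap : ∀ {A B : Set} (p : B → Bool) (G : A → List B) xs →
                   countL p (concatMap G xs) ≡ sumL (countL p ∘ G) xs
countL-concatMap p G []       = refl
countL-concatMap p G (x ∷ xs) =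
  trans (countL-++ p (G x) (concatMap G xs)) (cong (countL p (G x) +_) (countL-concatMap p G xs))

countL≡sumL : ∀ {A : Set} (p : A → Bool) xs → countL p xs ≡ sumL (indicator ∘ p) xs
countL≡sumL p []       = refl
countL≡sumL p (x ∷ xs) = cong (indicator (p x) +_) (countL≡sumL p xs)

sumFin : ∀ {k} → (Fin k → ℕ) → ℕ
sumFin {zero}  g = 0
sumFin {suc k} g = g zero + sumFin (g ∘ suc)

sumL-tabulate : ∀ {A : Set} {k} (g : A → ℕ) (f : Fin k → A) → sumL g (List.tabulate f) ≡ sumFin (g ∘ f)
sumL-tabulate {k = zero}  g f = refl
sumL-tabulate {k = suc k} g f = cong (g (f zero) +_) (sumL-tabulate g (f ∘ suc))

sumFin-toℕ : ∀ k (h : ℕ → ℕ) → sumFin {k} (h ∘ toℕ) ≡ sumTo k h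
sumFin-toℕ zero    h = refl
sumFin-toℕ (suc k) h = cong (h 0 +_) (sumFin-toℕ k (h ∘ suc))

sumL-allFin : ∀ n (h : ℕ → ℕ) → sumL (h ∘ toℕ) (allFin n) ≡ sumTo n h
sumL-allFin n h = trans (sumL-tabulate {k = n} (h ∘ toℕ) (λ x → x)) (sumFin-toℕ n h)

sumTo-indicator-≟ : ∀ K c → c < K → sumTo K (λ s → indicator (does (s ≟ c))) ≡ 1
sumTo-indicator-≟ (suc K) c c<1+K with K ≟ c
... | yes refl = begin
  sumTo (suc K) (λ s → indicator (does (s ≟ K)))                       ≡⟨ sumTo-suc K _ ⟩
  sumTo K (λ s → indicator (does (s ≟ K))) + indicator (does (K ≟ K))
    ≡⟨ cong₂ _+_ (sumTo≡0 K _ (λ s s<K → cong indicator (dec-false (s ≟ K) (<⇒≢ s<K))))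
                 (cong indicator (dec-true (K ≟ K) refl)) ⟩
  1                                                                    ∎
  where open ≡-Reasoning
... | no K≢c = trans (sumTo-suc K _)
                     (cong₂ _+_ (sumTo-indicator-≟ K c (≤∧≢⇒< (s≤s⁻¹ c<1+K) (K≢c ∘ sym)))
                                (cong indicator (dec-false (K ≟ c) K≢c)))

module TuranCount (r : ℕ) where

  M : ℕ
  M = suc r

  sameClass : ℕ → ℕ → Bool
  sameClass i j = does (i % M ≟ j % M)

  -- the number of earlier vertices in the class of j, i.e. ⌊j / M⌋
  q : ℕ → ℕ
  q j = sumTo j (λ i → indicator (sameClass i j))

  orderedPairs : ℕ → List (ℕ × ℕ)
  orderedPairs n = concatMap (λ j → map (λ i → (toℕ i , toℕ j)) (allFin (toℕ j))) (allFin n)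

  sameClassPair : ℕ × ℕ → Bool
  sameClassPair (i , j) = sameClass i j

  countL-orderedPairs : ∀ n (p : ℕ × ℕ → Bool) →
                        countL p (orderedPairs n) ≡ sumTo n (λ j → sumTo j (λ i → indicator (p (i , j))))
  countL-orderedPairs n p = begin
    countL p (orderedPairs n)                                               ≡⟨ countL-concatMap p _ (allFin n) ⟩
    sumL (λ j → countL p (map (λ i → (toℕ i , toℕ j)) (allFin (toℕ j)))) (allFin n)
      ≡⟨ sumL-cong (allFin n) (λ j → row (toℕ j)) ⟩
    sumL ((λ j → sumTo j (λ i → indicator (p (i , j)))) ∘ toℕ) (allFin n)   ≡⟨ sumL-allFin n _ ⟩
    sumTo n (λ j → sumTo j (λ i → indicator (p (i , j))))                   ∎
    where
    open ≡-Reasoning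
    row : ∀ j → countL p (map (λ i → (toℕ i , j)) (allFin j)) ≡ sumTo j (λ i → indicator (p (i , j)))
    row j = trans (countL-map p _ (allFin j))
                  (trans (countL≡sumL _ (allFin j)) (sumL-allFin j (λ i → indicator (p (i , j)))))

  C2∸turan≡sumTo : ∀ n → n C 2 ∸ turan n M ≡ sumTo n q
  C2∸turan≡sumTo n = begin
    n C 2 ∸ turan n M                                                   ≡⟨ cong (_∸ turan n M) C2≡turan+same ⟩
    (turan n M + countL sameClassPair (orderedPairs n)) ∸ turan n M     ≡⟨ m+n∸m≡n (turan n M) _ ⟩
    countL sameClassPair (orderedPairs n)                               ≡⟨ countL-orderedPairs n sameClassPair ⟩
    sumTo n q                                                           ∎
    where
    open ≡-Reasoning
    C2≡turan+same : n C 2 ≡ turan n M + countL sameClassPair (orderedPairs n)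
    C2≡turan+same = begin
      n C 2                                                ≡⟨ sumTo-id n ⟨
      sumTo n (λ j → j)                                    ≡⟨ sumTo-cong n _ _ (λ j _ → sumTo-1 j) ⟨
      sumTo n (λ j → sumTo j (λ _ → 1))                    ≡⟨ countL-orderedPairs n (λ _ → true) ⟨
      countL (λ _ → true) (orderedPairs n)                 ≡⟨ countL-split (λ _ → true) sameClassPair (orderedPairs n) ⟩
      countL (not ∘ sameClassPair) (orderedPairs n) + countL sameClassPair (orderedPairs n)
        ≡⟨ cong (_+ countL sameClassPair (orderedPairs n))
                (length-filter (λ p → ¬? (proj₁ p % M ≟ proj₂ p % M)) (orderedPairs n)) ⟨
      turan n M + countL sameClassPair (orderedPairs n)    ∎

  q-small : ∀ j → j < M → q j ≡ 0
  q-small j j<M = sumTo≡0 j _ (λ i i<j → cong indicator (dec-false (i % M ≟ j % M) (different i i<j)))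
    where
    different : ∀ i → i < j → i % M ≢ j % M
    different i i<j rewrite m<n⇒m%n≡m (<-trans i<j j<M) | m<n⇒m%n≡m j<M = <⇒≢ i<j

  q-shift : ∀ a → q (M + a) ≡ suc (q a)
  q-shift a = begin
    q (M + a)                                                        ≡⟨ sumTo-+ M a (λ i → indicator (sameClass i (M + a))) ⟩
    sumTo M (λ i → indicator (sameClass i (M + a))) + sumTo a (λ i → indicator (sameClass (M + i) (M + a)))
      ≡⟨ cong₂ _+_ (trans (sumTo-cong M _ _ (λ i i<M → cong indicator (firstRow i i<M)))
                          (sumTo-indicator-≟ M (a % M) (m%n<n a M)))
                   (sumTo-cong a _ _ (λ i _ → cong indicator (laterRows i))) ⟩
    suc (q a)                                                        ∎
    where
    open ≡-Reasoning
    mod-shift : ∀ x → (M + x) % M ≡ x % M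
    mod-shift x = trans (cong (_% M) (+-comm M x)) ([m+n]%n≡m%n x M)
    firstRow : ∀ i → i < M → sameClass i (M + a) ≡ does (i ≟ a % M)
    firstRow i i<M rewrite mod-shift a | m<n⇒m%n≡m i<M = refl
    laterRows : ∀ i → sameClass (M + i) (M + a) ≡ sameClass i a
    laterRows i rewrite mod-shift a | mod-shift i = refl

  M*q≤ : ∀ N → M * q N ≤ N
  M*q≤ = <-rec (λ N → M * q N ≤ N) induct
    where
    induct : ∀ N → (∀ {K} → K < N → M * q K ≤ K) → M * q N ≤ N
    induct N rec with N <? M
    ... | yes N<M rewrite q-small N N<M | *-zeroʳ M = z≤n
    ... | no N≮M with m≤n⇒∃[o]m+o≡n (≮⇒≥ N≮M)
    ...   | a , refl rewrite q-shift a | *-suc M (q a) = +-monoʳ-≤ M (rec (m<n+m a (s≤s z≤n)))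

-- The lower bound

∣tabulate∣≡count : ∀ {n} (f : Fin n → Bool) → ∣ tabulate f ∣ ≡ count f
∣tabulate∣≡count {zero} f = refl
∣tabulate∣≡count {suc n} f with f zero
... | true = cong suc (∣tabulate∣≡count (f ∘ suc))
... | false = ∣tabulate∣≡count (f ∘ suc)

closure⊆independent : ∀ {n} (H : Hypergraph n) (S : Fin n → Bool) → Independent (arcs H) S →
                      ∀ x → InClosure H (tabulate S) x → S x ≡ true
closure⊆independent H S ind x (base m) = trans (sym (lookup∘tabulate S x)) ([]=⇒lookup m)
closure⊆independent H S ind _ (step a m cu cv) =
  ⊥-elim (ind a m (closure⊆independent H S ind _ cu) (closure⊆independent H S ind _ cv))

good⇒noIndependentSet : ∀ {n k} (H : Hypergraph n) → k < n → Good k H →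
                        NoIndependentSet (arcs H) k (λ _ → true)
good⇒noIndependentSet {n} H k<n good S _ |S| indS with count<n⇒∃false S (subst (_< n) (sym |S|) k<n)
... | x , Sx = true≢false (trans (sym (closure⊆independent H S indS x closed)) Sx)
  where
  closed : InClosure H (tabulate S) x
  closed = good (tabulate S) (trans (∣tabulate∣≡count S) |S|) x

lowerBound : ∀ n r → suc (suc r) < n → (H : Hypergraph n) → Good (suc (suc r)) H →
             n C 2 ∸ turan n (suc r) ≤ size H
lowerBound n r k<n H good = begin
  n C 2 ∸ turan n (suc r)            ≡⟨ TuranCount.C2∸turan≡sumTo r n ⟩
  sumTo n (TuranCount.q r)           ≤⟨ edgesWithin≥sumTo (arcs H) (suc r) (TuranCount.q r) (TuranCount.M*q≤ r)
                                          n (λ _ → true) (count-true n) (good⇒noIndependentSet H k<n good) ⟩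
  edgesWithin (arcs H) (λ _ → true)  ≡⟨ countL-true (arcs H) ⟩
  size H                             ∎
  where open ≤-Reasoning

sumTo-+-distrib : ∀ K (f g : ℕ → ℕ) → sumTo K (λ s → f s + g s) ≡ sumTo K f + sumTo K g
sumTo-+-distrib zero    f g = refl
sumTo-+-distrib (suc K) f g =
  trans (cong (f 0 + g 0 +_) (sumTo-+-distrib K (f ∘ suc) (g ∘ suc))) (+-interchange (f 0) (g 0) _ _)

count-partition : ∀ {n} (X : Fin n → Bool) K (g : Fin n → ℕ) → (∀ y → g y < K) →
                  count X ≡ sumTo K (λ s → count (λ y → X y ∧ does (s ≟ g y)))
count-partition {zero}  X K g g<K = sym (sumTo≡0 K _ (λ _ _ → refl))
count-partition {suc n} X K g g<K =
  sym (trans (sumTo-+-distrib K _ _) (cong₂ _+_ first (sym (count-partition (X ∘ suc) K (g ∘ suc) (g<K ∘ suc)))))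
  where
  first : sumTo K (λ s → indicator (X zero ∧ does (s ≟ g zero))) ≡ indicator (X zero)
  first with X zero
  ... | true  = sumTo-indicator-≟ K (g zero) (g<K zero)
  ... | false = sumTo≡0 K _ (λ _ _ → refl)

sumTo>⇒∃≥2 : ∀ K (c : ℕ → ℕ) → K < sumTo K c → Σ ℕ λ s → 2 ≤ c s
sumTo>⇒∃≥2 (suc K) c lt with 2 ≤? c 0
... | yes 2≤c0 = 0 , 2≤c0
... | no 2≰c0 with sumTo>⇒∃≥2 K (c ∘ suc) (+-cancelˡ-< 1 K _ (≤-trans lt (+-monoˡ-≤ _ (s≤s⁻¹ (≰⇒> 2≰c0)))))
...   | s , 2≤cs = suc s , 2≤cs

count≥2⇒two : ∀ {n} (Z : Fin n → Bool) → 2 ≤ count Z →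
              Σ (Fin n) λ y₁ → Σ (Fin n) λ y₂ → y₁ ≢ y₂ × Z y₁ ≡ true × Z y₂ ≡ true
count≥2⇒two Z 2≤|Z| with count>0⇒∃true Z (≤-trans (s≤s z≤n) 2≤|Z|)
... | y₁ , Zy₁ with count>0⇒∃true (without Z y₁) (s≤s⁻¹ (subst (2 ≤_) (count-without Z y₁ Zy₁) 2≤|Z|))
...   | y₂ , y₂∈Z∖y₁ = y₁ , y₂ , y₁≢y₂ , Zy₁ , without⊆ Z y₁ y₂ y₂∈Z∖y₁
  where
  y₁≢y₂ : y₁ ≢ y₂
  y₁≢y₂ e = true≢false (trans (sym (subst (λ z → without Z y₁ z ≡ true) (sym e) y₂∈Z∖y₁))
                              (trans (cong (λ b → Z y₁ ∧ not b) (==-refl y₁)) (∧-zeroʳ (Z y₁))))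

pigeonhole : ∀ {n} (X : Fin n → Bool) K (g : Fin n → ℕ) → (∀ y → g y < K) → K < count X →
             Σ (Fin n) λ y₁ → Σ (Fin n) λ y₂ → y₁ ≢ y₂ × X y₁ ≡ true × X y₂ ≡ true × g y₁ ≡ g y₂
pigeonhole X K g g<K K<|X| with sumTo>⇒∃≥2 K _ (subst (K <_) (count-partition X K g g<K) K<|X|)
... | s , 2≤ with count≥2⇒two _ 2≤
...   | y₁ , y₂ , y₁≢y₂ , h₁ , h₂ =
  y₁ , y₂ , y₁≢y₂ , ∧-conicalˡ _ _ h₁ , ∧-conicalˡ _ _ h₂ , trans (sym (inClass y₁ h₁)) (inClass y₂ h₂)
  where
  inClass : ∀ y → X y ∧ does (s ≟ g y) ≡ true → s ≡ g y
  inClass y h = does≡true⇒ (s ≟ g y) (∧-conicalʳ (X y) _ h)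

-- The construction

-- With M = r + 1 = k − 1 classes, class t < M consists of the vertices V t 0 < V t 1 < … below n
-- that are ≡ t mod M.
module Layout (n r : ℕ) (M+M≤n : suc r + suc r ≤ n) (M+2≤n : suc (suc (suc r)) ≤ n) where

  M : ℕ
  M = suc r

  V : ℕ → ℕ → ℕ
  V t i = t + i * M

  V-suc : ∀ t i → V t (suc i) ≡ V t i + M
  V-suc t i = trans (cong (t +_) (+-comm M (i * M))) (sym (+-assoc t (i * M) M))

  V-mono : ∀ t {i j} → i < j → V t i < V t j
  V-mono t i<j = +-monoʳ-< t (*-monoˡ-< M i<j)

  V-mono-≤ : ∀ t {i j} → i ≤ j → V t i ≤ V t j
  V-mono-≤ t i≤j = +-monoʳ-≤ t (*-monoˡ-≤ M i≤j)

  V-cancel-< : ∀ t {i j} → V t i < V t j → i < j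
  V-cancel-< t {i} {j} lt with i <? j
  ... | yes i<j = i<j
  ... | no i≮j  = ⊥-elim (<⇒≱ lt (V-mono-≤ t (≮⇒≥ i≮j)))

  V-injective : ∀ t {i j} → V t i ≡ V t j → i ≡ j
  V-injective t {i} {j} e with <-cmp i j
  ... | tri< lt _ _ = ⊥-elim (<⇒≢ (V-mono t lt) e)
  ... | tri≈ _ eq _ = eq
  ... | tri> _ _ gt = ⊥-elim (<⇒≢ (V-mono t gt) (sym e))

  V%M : ∀ t i → t < M → V t i % M ≡ t
  V%M t i t<M = trans ([m+kn]%n≡m%n t i M) (m<n⇒m%n≡m t<M)

  V-decompose : ∀ x → x ≡ V (x % M) (x / M)
  V-decompose x = m≡m%n+[m/n]*n x M

  V-decompose-pair : ∀ a b → a < b → a % M ≡ b % M →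
                     a ≡ V (b % M) (a / M) × b ≡ V (b % M) (b / M) × a / M < b / M
  V-decompose-pair a b a<b sameClass = ea , eb , V-cancel-< (b % M) (subst₂ _<_ ea eb a<b)
    where
    ea : a ≡ V (b % M) (a / M)
    ea = trans (V-decompose a) (cong (λ z → V z (a / M)) sameClass)
    eb : b ≡ V (b % M) (b / M)
    eb = V-decompose b

  M≤V-suc : ∀ t i → M ≤ V t (suc i)
  M≤V-suc t i = ≤-trans (m≤m+n M (i * M)) (m≤n+m (M + i * M) t)

  V0<M : ∀ t → t < M → V t 0 < M
  V0<M t t<M = subst (_< M) (sym (+-identityʳ t)) t<M

  V1<n : ∀ t → t < M → V t 1 < n
  V1<n t t<M = ≤-trans (+-monoˡ-< (M + 0) t<M) (subst (λ z → M + z ≤ n) (sym (+-identityʳ M)) M+M≤n)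

  M≡1⇒notLast : M ≡ 1 → ∀ t → t ≡ 0 → n ≤ V t 1 + M → ⊥
  M≡1⇒notLast M≡1 t t≡0 last = <⇒≱ (≤-trans M+2≤n (≤-trans last (≤-reflexive V1+M≡2))) (s≤s (s≤s z≤n))
    where
    V1+M≡2 : V t 1 + M ≡ 2
    V1+M≡2 = cong₂ (λ a b → a + (b + 0) + b) t≡0 M≡1

  nextFirst : ℕ → ℕ
  nextFirst b = suc (b % M) % M

  wraps : ℕ → ℕ → Bool
  wraps a b = does (b ≟ a + M) ∧ does (n ≤? b + M)

  -- The head of the arc on a same-class pair a < b: for the last two vertices of a class, the
  -- first vertex of the next class; if a is first in its class, the successor of b when b is second
  -- and the predecessor of b otherwise; for any other a, the successor of b, or the predecessor of a
  -- when b is last.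
  head : ℕ → ℕ → ℕ
  head a b = if wraps a b then nextFirst b
             else (if does (a <? M) then (if does (b ≟ a + M) then b + M else b ∸ M)
                   else (if does (b + M <? n) then b + M else a ∸ M))

  ValidHead : ℕ → ℕ → Set
  ValidHead a b = head a b < n × head a b ≢ a × head a b ≢ b

  module _ (t : ℕ) (t<M : t < M) where

    nextFirst-V : ∀ j → nextFirst (V t j) ≡ suc t % M
    nextFirst-V j = cong (λ z → suc z % M) (V%M t j t<M)

    head-wrap : ∀ i → n ≤ V t (suc i) + M → head (V t i) (V t (suc i)) ≡ suc t % M
    head-wrap i last
      rewrite dec-true (V t (suc i) ≟ V t i + M) (V-suc t i) | dec-true (n ≤? V t (suc i) + M) last
      = nextFirst-V (suc i)

    head-first-second : V t 1 + M < n → head (V t 0) (V t 1) ≡ V t 2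
    head-first-second notLast
      rewrite dec-true (V t 1 ≟ V t 0 + M) (V-suc t 0) | dec-false (n ≤? V t 1 + M) (<⇒≱ notLast)
            | dec-true (V t 0 <? M) (V0<M t t<M)
      = sym (V-suc t 1)

    far≢second : ∀ j → V t (suc (suc j)) ≢ V t 0 + M
    far≢second j e with suc-injective {suc j} {0} (V-injective t {suc (suc j)} {1} (trans e (sym (V-suc t 0))))
    ... | ()

    head-first-far : ∀ j → head (V t 0) (V t (suc (suc j))) ≡ V t (suc j)
    head-first-far j
      rewrite dec-false (V t (suc (suc j)) ≟ V t 0 + M) (far≢second j) | dec-true (V t 0 <? M) (V0<M t t<M)
      = trans (cong (_∸ M) (V-suc t (suc j))) (m+n∸n≡m (V t (suc j)) M)

    head-up : ∀ i j → V t j + M < n → head (V t (suc i)) (V t j) ≡ V t (suc j)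
    head-up i j notLast
      rewrite dec-false (n ≤? V t j + M) (<⇒≱ notLast) | ∧-zeroʳ (does (V t j ≟ V t (suc i) + M))
            | dec-false (V t (suc i) <? M) (≤⇒≯ (M≤V-suc t i)) | dec-true (V t j + M <? n) notLast
      = sym (V-suc t j)

    head-down : ∀ i j → n ≤ V t j + M → j ≢ suc (suc i) → head (V t (suc i)) (V t j) ≡ V t i
    head-down i j last j≢i+2
      rewrite dec-false (V t j ≟ V t (suc i) + M) (λ e → j≢i+2 (V-injective t (trans e (sym (V-suc t (suc i))))))
            | dec-false (V t (suc i) <? M) (≤⇒≯ (M≤V-suc t i)) | dec-false (V t j + M <? n) (≤⇒≯ last)
      = trans (cong (_∸ M) (V-suc t i)) (m+n∸n≡m (V t i) M)

  suc%M≡⇒M≡1 : ∀ t → t < M → suc t % M ≡ t → M ≡ 1 × t ≡ 0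
  suc%M≡⇒M≡1 t t<M e with suc t <? M
  ... | yes t+1<M = ⊥-elim (1+n≢n (trans (sym (m<n⇒m%n≡m t+1<M)) e))
  ... | no t+1≮M  = M≡1 , t≡0
    where
    t+1≡M : suc t ≡ M
    t+1≡M = ≤-antisym t<M (≮⇒≥ t+1≮M)
    t≡0 : t ≡ 0
    t≡0 = trans (sym e) (trans (cong (_% M) t+1≡M) (n%n≡0 M))
    M≡1 : M ≡ 1
    M≡1 = trans (sym t+1≡M) (cong suc t≡0)

  %M≡0 : M ≡ 1 → ∀ x → x % M ≡ 0
  %M≡0 M≡1 x rewrite suc-injective M≡1 = n%1≡0 x

  suc%M≢V : ∀ t x → t < M → (M ≡ 1 → t ≡ 0 → x ≢ 0) → suc t % M ≢ V t x
  suc%M≢V t x t<M x≢0 e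
    with suc%M≡⇒M≡1 t t<M (trans (sym (m%n%n≡m%n (suc t) M)) (trans (cong (_% M) e) (V%M t x t<M)))
  ... | M≡1 , t≡0 = x≢0 M≡1 t≡0 (m*n≡0⇒m≡0 x M (m+n≡0⇒n≡0 t (sym (trans (sym (%M≡0 M≡1 (suc t))) e))))

  nextFirst<n : ∀ t → suc t % M < n
  nextFirst<n t = ≤-trans (m%n<n (suc t) M) (≤-trans (m≤m+n M M) M+M≤n)

  head-valid-V : ∀ t i j → t < M → i < j → V t j < n → ValidHead (V t i) (V t j)
  head-valid-V t zero (suc zero) t<M _ j<n with n ≤? V t 1 + M
  ... | yes last rewrite head-wrap t t<M 0 last =
    nextFirst<n t , suc%M≢V t 0 t<M (λ M≡1 t≡0 _ → M≡1⇒notLast M≡1 t t≡0 last) , suc%M≢V t 1 t<M (λ _ _ ())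
  ... | no notLast rewrite head-first-second t t<M (≰⇒> notLast) =
    subst (_< n) (sym (V-suc t 1)) (≰⇒> notLast) ,
    (λ e → 1+n≢0 {1} (V-injective t e)) , (λ e → 1+n≢0 {0} (suc-injective (V-injective t e)))
  head-valid-V t zero (suc (suc j)) t<M _ j<n rewrite head-first-far t t<M j =
    <-trans (V-mono t (n<1+n (suc j))) j<n ,
    (λ e → 1+n≢0 {j} (V-injective t e)) , (λ e → 1+n≢n (sym (V-injective t {suc j} {suc (suc j)} e)))
  head-valid-V t (suc i) j t<M i<j j<n with n ≤? V t j + M
  ... | no notLast rewrite head-up t t<M i j (≰⇒> notLast) =
    subst (_< n) (sym (V-suc t j)) (≰⇒> notLast) ,
    (λ e → <⇒≢ (<-trans i<j (n<1+n j)) (sym (V-injective t {suc j} {suc i} e))) ,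
    (λ e → 1+n≢n (V-injective t {suc j} {j} e))
  ... | yes last with j ≟ suc (suc i)
  ...   | yes refl rewrite head-wrap t t<M (suc i) last =
    nextFirst<n t , suc%M≢V t (suc i) t<M (λ _ _ ()) , suc%M≢V t (suc (suc i)) t<M (λ _ _ ())
  ...   | no j≢i+2 rewrite head-down t t<M i j last j≢i+2 =
    <-trans (V-mono t (n<1+n i)) (<-trans (V-mono t i<j) j<n) ,
    (λ e → 1+n≢n (sym (V-injective t {i} {suc i} e))) ,
    (λ e → <⇒≢ (<-trans (n<1+n i) i<j) (V-injective t {i} {j} e))

module Construction (n r : ℕ) (M+M≤n : suc r + suc r ≤ n) (M+2≤n : suc (suc (suc r)) ≤ n) where
  open Layout n r M+M≤n M+2≤n

  M≤n : M ≤ n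
  M≤n = ≤-trans (m≤m+n M M) M+M≤n

  head-valid : ∀ a b → a < b → b < n → a % M ≡ b % M → ValidHead a b
  head-valid a b a<b b<n sameClass with V-decompose-pair a b a<b sameClass
  ... | ea , eb , i<j =
    subst₂ ValidHead (sym ea) (sym eb) (head-valid-V (b % M) (a / M) (b / M) (m%n<n b M) i<j (subst (_< n) eb b<n))

  mkArc : (a b c : ℕ) → a < n → b < n → c < n → a < b → c ≢ a → c ≢ b → Hyperarc n
  mkArc a b c an bn cn ab ca cb = arc (fromℕ< an) (fromℕ< bn) (fromℕ< cn)
     (subst₂ _<_ (sym (toℕ-fromℕ< an)) (sym (toℕ-fromℕ< bn)) ab)
     (λ e → ca (trans (sym (toℕ-fromℕ< cn)) (trans (cong toℕ e) (toℕ-fromℕ< an))))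
     (λ e → cb (trans (sym (toℕ-fromℕ< cn)) (trans (cong toℕ e) (toℕ-fromℕ< bn))))

  Ends : Hyperarc n → ℕ → ℕ → ℕ → Set
  Ends x a b c = toℕ (u x) ≡ a × toℕ (v x) ≡ b × toℕ (w x) ≡ c

  ArcIn : List (Hyperarc n) → ℕ → ℕ → ℕ → Set
  ArcIn A a b c = Σ (Hyperarc n) λ x → x ∈ˡ A × Ends x a b c

  arcIfSameClass : (a b : ℕ) → a < b → b < n → Dec (a % M ≡ b % M) → List (Hyperarc n)
  arcIfSameClass a b ab bn (yes e) with head-valid a b ab bn e
  ... | c<n , c≢a , c≢b = mkArc a b (head a b) (<-trans ab bn) bn c<n ab c≢a c≢b ∷ []
  arcIfSameClass a b ab bn (no _) = []

  pairArc : (a b : ℕ) → a < b → b < n → List (Hyperarc n)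
  pairArc a b ab bn = arcIfSameClass a b ab bn (a % M ≟ b % M)

  pairArcsBelow : (b : ℕ) → b < n → (a : ℕ) → a ≤ b → List (Hyperarc n)
  pairArcsBelow b bn zero _ = []
  pairArcsBelow b bn (suc a) le = pairArcsBelow b bn a (≤-trans (n≤1+n a) le) ++ pairArc a b le bn

  sameClassArcs : (b : ℕ) → b ≤ n → List (Hyperarc n)
  sameClassArcs zero _ = []
  sameClassArcs (suc b) le = sameClassArcs b (≤-trans (n≤1+n b) le) ++ pairArcsBelow b le b ≤-refl

  length-pairArc : ∀ a b ab bn → length (pairArc a b ab bn) ≡ indicator (TuranCount.sameClass r a b)
  length-pairArc a b ab bn = byCases (a % M ≟ b % M)
    where byCases : ∀ d → length (arcIfSameClass a b ab bn d) ≡ indicator (does d)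
          byCases (yes _) = refl
          byCases (no _) = refl

  length-pairArcsBelow : ∀ b bn a le →
                         length (pairArcsBelow b bn a le) ≡ sumTo a (λ i → indicator (TuranCount.sameClass r i b))
  length-pairArcsBelow b bn zero le = refl
  length-pairArcsBelow b bn (suc a) le = trans (length-++ (pairArcsBelow b bn a _))
     (trans (cong₂ _+_ (length-pairArcsBelow b bn a _) (length-pairArc a b le bn)) (sym (sumTo-suc a _)))

  length-sameClassArcs : ∀ b le → length (sameClassArcs b le) ≡ sumTo b (TuranCount.q r)
  length-sameClassArcs zero le = refl
  length-sameClassArcs (suc b) le = trans (length-++ (sameClassArcs b _))
     (trans (cong₂ _+_ (length-sameClassArcs b _) (length-pairArcsBelow b le b ≤-refl))
            (sym (sumTo-suc b (TuranCount.q r))))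

  pairArc∋ : ∀ a b ab bn → a % M ≡ b % M → ArcIn (pairArc a b ab bn) a b (head a b)
  pairArc∋ a b ab bn e = byCases (a % M ≟ b % M)
    where byCases : ∀ d → ArcIn (arcIfSameClass a b ab bn d) a b (head a b)
          byCases (yes _) = _ , here refl , toℕ-fromℕ< _ , toℕ-fromℕ< _ , toℕ-fromℕ< _
          byCases (no ne) = ⊥-elim (ne e)

  pairArcsBelow∋ : ∀ b bn a' le a → a < a' → a % M ≡ b % M → ArcIn (pairArcsBelow b bn a' le) a b (head a b)
  pairArcsBelow∋ b bn zero le a () e
  pairArcsBelow∋ b bn (suc a') le a lt e with a ≟ a'
  ... | yes refl with pairArc∋ a b le bn e
  ...   | x , m , tr = x , ∈-++⁺ʳ (pairArcsBelow b bn a _) m , tr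
  pairArcsBelow∋ b bn (suc a') le a lt e | no ne
    with pairArcsBelow∋ b bn a' (≤-trans (n≤1+n a') le) a (≤∧≢⇒< (s≤s⁻¹ lt) ne) e
  ...   | x , m , tr = x , ∈-++⁺ˡ m , tr

  sameClassArcs∋ : ∀ b' le a b → a < b → b < b' → a % M ≡ b % M → ArcIn (sameClassArcs b' le) a b (head a b)
  sameClassArcs∋ zero le a b ab ()
  sameClassArcs∋ (suc b') le a b ab bb e with b ≟ b'
  ... | yes refl with pairArcsBelow∋ b le b ≤-refl a ab e
  ...   | x , m , tr = x , ∈-++⁺ʳ (sameClassArcs b _) m , tr
  sameClassArcs∋ (suc b') le a b ab bb e | no ne
    with sameClassArcs∋ b' (≤-trans (n≤1+n b') le) a b ab (≤∧≢⇒< (s≤s⁻¹ bb) ne) e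
  ...   | x , m , tr = x , ∈-++⁺ˡ m , tr

  SameClassBody : Hyperarc n → Set
  SameClassBody x = toℕ (u x) % M ≡ toℕ (v x) % M

  pairArc-ends : ∀ a b ab bn x → x ∈ˡ pairArc a b ab bn → toℕ (u x) ≡ a × toℕ (v x) ≡ b × SameClassBody x
  pairArc-ends a b ab bn x m = byCases (a % M ≟ b % M) m
    where byCases : ∀ d → x ∈ˡ arcIfSameClass a b ab bn d → toℕ (u x) ≡ a × toℕ (v x) ≡ b × SameClassBody x
          byCases (yes e) (here refl) =
            toℕ-fromℕ< _ , toℕ-fromℕ< _ ,
            subst₂ (λ p q → p % M ≡ q % M) (sym (toℕ-fromℕ< (<-trans ab bn))) (sym (toℕ-fromℕ< bn)) e
          byCases (no _) ()

  pairArcsBelow-ends : ∀ b bn a le x → x ∈ˡ pairArcsBelow b bn a le →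
                       toℕ (u x) < a × toℕ (v x) ≡ b × SameClassBody x
  pairArcsBelow-ends b bn zero le x ()
  pairArcsBelow-ends b bn (suc a) le x m with ∈-++⁻ (pairArcsBelow b bn a _) m
  ... | inj₁ m1 = let (p , q , s) = pairArcsBelow-ends b bn a _ x m1 in ≤-trans p (n≤1+n a) , q , s
  ... | inj₂ m2 = let (p , q , s) = pairArc-ends a b le bn x m2 in ≤-reflexive (cong suc p) , q , s

  sameClassArcs-ends : ∀ b le x → x ∈ˡ sameClassArcs b le → toℕ (v x) < b × SameClassBody x
  sameClassArcs-ends zero le x ()
  sameClassArcs-ends (suc b) le x m with ∈-++⁻ (sameClassArcs b _) m
  ... | inj₁ m1 = let (p , s) = sameClassArcs-ends b _ x m1 in ≤-trans p (n≤1+n b) , s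
  ... | inj₂ m2 = let (p , q , s) = pairArcsBelow-ends b le b ≤-refl x m2 in ≤-reflexive (cong suc q) , s

  pairArc-unique : ∀ a b ab bn → Unique (pairArc a b ab bn)
  pairArc-unique a b ab bn = byCases (a % M ≟ b % M)
    where byCases : ∀ d → Unique (arcIfSameClass a b ab bn d)
          byCases (yes _) = [] ∷ []
          byCases (no _) = []

  pairArcsBelow-unique : ∀ b bn a le → Unique (pairArcsBelow b bn a le)
  pairArcsBelow-unique b bn zero le = []
  pairArcsBelow-unique b bn (suc a) le = UP.++⁺ (pairArcsBelow-unique b bn a _) (pairArc-unique a b le bn) disjoint
    where
    disjoint : ∀ {x} → ¬ (x ∈ˡ pairArcsBelow b bn a _ × x ∈ˡ pairArc a b le bn)
    disjoint {x} (m1 , m2) = <⇒≢ (proj₁ (pairArcsBelow-ends b bn a _ x m1)) (proj₁ (pairArc-ends a b le bn x m2))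

  sameClassArcs-unique : ∀ b le → Unique (sameClassArcs b le)
  sameClassArcs-unique zero le = []
  sameClassArcs-unique (suc b) le = UP.++⁺ (sameClassArcs-unique b _) (pairArcsBelow-unique b le b ≤-refl) disjoint
    where
    disjoint : ∀ {x} → ¬ (x ∈ˡ sameClassArcs b _ × x ∈ˡ pairArcsBelow b le b ≤-refl)
    disjoint {x} (m1 , m2) =
      <⇒≢ (proj₁ (sameClassArcs-ends b _ x m1)) (proj₁ (proj₂ (pairArcsBelow-ends b le b ≤-refl x m2)))

  lastStart : ℕ
  lastStart = n ∸ M

  M≤lastStart : M ≤ lastStart
  M≤lastStart = m+n≤o⇒m≤o∸n M M+M≤n

  lastStart+M : lastStart + M ≡ n
  lastStart+M = m∸n+n≡m M≤n

  nextFirst%M : ∀ x → nextFirst x % M ≡ nextFirst x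
  nextFirst%M x = m%n%n≡m%n (suc (x % M)) M

  -- For r ≠ 0, each of the last M vertices b (the last vertex of its class) gets the extra arc
  -- nextFirst b, b → nextFirst b + M, whose head is the second vertex of the next class.
  module Wrap (r≢0 : r ≢ 0) where
    nextFirst≢class : ∀ b → nextFirst b ≢ b % M
    nextFirst≢class b e = r≢0 (suc-injective (proj₁ (suc%M≡⇒M≡1 (b % M) (m%n<n b M) e)))

    wrapArc : (d : ℕ) → d < M → Hyperarc n
    wrapArc d dM = mkArc (nextFirst b) b (nextFirst b + M) fbn bn fMn fb<b ne1 ne2
      where
      b : ℕ
      b = lastStart + d
      fbM : nextFirst b < M
      fbM = m%n<n (suc (b % M)) M
      fbn : nextFirst b < n
      fbn = ≤-trans fbM M≤n
      bn : b < n
      bn = subst (b <_) lastStart+M (+-monoʳ-< lastStart dM)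
      fMn : nextFirst b + M < n
      fMn = ≤-trans (+-monoˡ-< M fbM) M+M≤n
      fb<b : nextFirst b < b
      fb<b = ≤-trans fbM (≤-trans M≤lastStart (m≤m+n lastStart d))
      ne1 : nextFirst b + M ≢ nextFirst b
      ne1 e = 1+n≢0 {r} (+-cancelˡ-≡ (nextFirst b) M 0 (trans e (sym (+-identityʳ (nextFirst b)))))
      ne2 : nextFirst b + M ≢ b
      ne2 e = nextFirst≢class b
                (trans (sym (nextFirst%M b)) (trans (sym ([m+n]%n≡m%n (nextFirst b) M)) (cong (_% M) e)))

    wrapArcs : (d : ℕ) → d ≤ M → List (Hyperarc n)
    wrapArcs zero _ = []
    wrapArcs (suc d) le = wrapArcs d (≤-trans (n≤1+n d) le) ++ [ wrapArc d le ]

    length-wrapArcs : ∀ d le → length (wrapArcs d le) ≡ d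
    length-wrapArcs zero le = refl
    length-wrapArcs (suc d) le =
      trans (length-++ (wrapArcs d _)) (trans (cong (_+ 1) (length-wrapArcs d _)) (+-comm d 1))

    wrapArcs-ends : ∀ d le x → x ∈ˡ wrapArcs d le → toℕ (v x) < lastStart + d × ¬ SameClassBody x
    wrapArcs-ends zero le x ()
    wrapArcs-ends (suc d) le x m with ∈-++⁻ (wrapArcs d _) m
    ... | inj₁ m1 = let (p , s) = wrapArcs-ends d _ x m1 in ≤-trans p (+-monoʳ-≤ lastStart (n≤1+n d)) , s
    ... | inj₂ (here refl) = ≤-reflexive (trans (cong suc (toℕ-fromℕ< _)) (sym (+-suc lastStart d))) ,
          λ s → nextFirst≢class (lastStart + d)
                  (trans (sym (nextFirst%M (lastStart + d)))
                         (subst₂ (λ p q → p % M ≡ q % M) (toℕ-fromℕ< {m = nextFirst (lastStart + d)} {n = n} _)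
                                 (toℕ-fromℕ< {m = lastStart + d} {n = n} _) s))

    wrapArcs-unique : ∀ d le → Unique (wrapArcs d le)
    wrapArcs-unique zero le = []
    wrapArcs-unique (suc d) le = UP.++⁺ (wrapArcs-unique d _) ([] ∷ []) disjoint
      where
      disjoint : ∀ {x} → ¬ (x ∈ˡ wrapArcs d _ × x ∈ˡ [ wrapArc d le ])
      disjoint {x} (m1 , here refl) = <⇒≢ (proj₁ (wrapArcs-ends d _ x m1)) (toℕ-fromℕ< _)

    wrapArcs∋′ : ∀ d le d' → d' < d → ArcIn (wrapArcs d le) (nextFirst (lastStart + d')) (lastStart + d') (nextFirst (lastStart + d') + M)
    wrapArcs∋′ zero le d' ()
    wrapArcs∋′ (suc d) le d' lt with d' ≟ d
    ... | yes refl = _ , ∈-++⁺ʳ (wrapArcs d _) (here refl) , toℕ-fromℕ< _ , toℕ-fromℕ< _ , toℕ-fromℕ< _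
    ... | no ne with wrapArcs∋′ d (≤-trans (n≤1+n d) le) d' (≤∧≢⇒< (s≤s⁻¹ lt) ne)
    ...   | x , m , tr = x , ∈-++⁺ˡ m , tr

    wrapArcs∋ : ∀ b → b < n → n ≤ b + M → ArcIn (wrapArcs M ≤-refl) (nextFirst b) b (nextFirst b + M)
    wrapArcs∋ b bn last = subst (λ z → ArcIn (wrapArcs M ≤-refl) (nextFirst z) z (nextFirst z + M)) eb
                          (wrapArcs∋′ M ≤-refl (b ∸ lastStart) d<M)
      where
      nM≤b : lastStart ≤ b
      nM≤b = subst (lastStart ≤_) (m+n∸n≡m b M) (∸-monoˡ-≤ M last)
      eb : lastStart + (b ∸ lastStart) ≡ b
      eb = m+[n∸m]≡n nM≤b
      d<M : b ∸ lastStart < M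
      d<M = +-cancelˡ-< lastStart (b ∸ lastStart) M (subst₂ _<_ (sym eb) (sym lastStart+M) bn)

  extraArcs : Dec (r ≡ 0) → List (Hyperarc n)
  extraArcs (yes _) = []
  extraArcs (no ne) = Wrap.wrapArcs ne M ≤-refl

  arcsH : List (Hyperarc n)
  arcsH = sameClassArcs n ≤-refl ++ extraArcs (r ≟ 0)

  arcsH-unique : Unique arcsH
  arcsH-unique = UP.++⁺ (sameClassArcs-unique n ≤-refl) (uniqueByCases (r ≟ 0)) disjoint
    where
    uniqueByCases : ∀ d → Unique (extraArcs d)
    uniqueByCases (yes _) = []
    uniqueByCases (no ne) = Wrap.wrapArcs-unique ne M ≤-refl
    notSameClass : ∀ d x → x ∈ˡ extraArcs d → ¬ SameClassBody x
    notSameClass (yes _) x ()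
    notSameClass (no ne) x m = proj₂ (Wrap.wrapArcs-ends ne M ≤-refl x m)
    disjoint : ∀ {x} → ¬ (x ∈ˡ sameClassArcs n ≤-refl × x ∈ˡ extraArcs (r ≟ 0))
    disjoint {x} (m1 , m2) = notSameClass (r ≟ 0) x m2 (proj₂ (sameClassArcs-ends n ≤-refl x m1))

  constructed : Hypergraph n
  constructed = hg arcsH arcsH-unique

  size-constructed : size constructed ≤ sumTo n (TuranCount.q r) + M
  size-constructed = begin
    length (sameClassArcs n ≤-refl ++ extraArcs (r ≟ 0))           ≡⟨ length-++ (sameClassArcs n ≤-refl) ⟩
    length (sameClassArcs n ≤-refl) + length (extraArcs (r ≟ 0))   ≡⟨ cong (_+ length (extraArcs (r ≟ 0))) (length-sameClassArcs n ≤-refl) ⟩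
    sumTo n (TuranCount.q r) + length (extraArcs (r ≟ 0))          ≤⟨ +-monoʳ-≤ (sumTo n (TuranCount.q r)) (extraLength (r ≟ 0)) ⟩
    sumTo n (TuranCount.q r) + M                                    ∎
    where
    open ≤-Reasoning
    extraLength : ∀ d → length (extraArcs d) ≤ M
    extraLength (yes _) = z≤n
    extraLength (no ne) = ≤-reflexive (Wrap.length-wrapArcs ne M ≤-refl)

  pairArc∈ : ∀ a b → a < b → b < n → a % M ≡ b % M → ArcIn arcsH a b (head a b)
  pairArc∈ a b ab bn e with sameClassArcs∋ n ≤-refl a b ab bn e
  ... | x , m , tr = x , ∈-++⁺ˡ m , tr

  wrapArc∈ : (ne : r ≢ 0) → ∀ b → b < n → n ≤ b + M → ArcIn arcsH (nextFirst b) b (nextFirst b + M)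
  wrapArc∈ ne b bn last with r ≟ 0
  ... | yes r0 = ⊥-elim (ne r0)
  ... | no ne' with Wrap.wrapArcs∋ ne' b bn last
  ...   | x , m , tr = x , ∈-++⁺ʳ (sameClassArcs n ≤-refl) m , tr

module ClosureOf (n r : ℕ) (M+M≤n : suc r + suc r ≤ n) (M+2≤n : suc (suc (suc r)) ≤ n) (S : Subset n) where
  open Layout n r M+M≤n M+2≤n
  open Construction n r M+M≤n M+2≤n

  Reached : ℕ → Set
  Reached x = Σ (Fin n) λ y → toℕ y ≡ x × InClosure constructed S y

  fire : ∀ x a b c → x ∈ˡ arcsH → Ends x a b c → Reached a → Reached b → Reached c
  fire x a b c m (ea , eb , ec) (ya , pa , ca) (yb , pb , cb) =
    w x , ec , step x m (subst (InClosure constructed S) (toℕ-injective (trans pa (sym ea))) ca)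
                        (subst (InClosure constructed S) (toℕ-injective (trans pb (sym eb))) cb)

  ClassReached : ℕ → Set
  ClassReached t = ∀ i → V t i < n → Reached (V t i)

  module InClass (t : ℕ) (tM : t < M) where

    ReachedAt : ℕ → Set
    ReachedAt i = Reached (V t i)

    fireInClass : ∀ i j → i < j → V t j < n → ReachedAt i → ReachedAt j → Reached (head (V t i) (V t j))
    fireInClass i j ij jn ci cj with pairArc∈ (V t i) (V t j) (V-mono t ij) jn (trans (V%M t i tM) (sym (V%M t j tM)))
    ... | x , m , tr = fire x _ _ _ m tr ci cj

    climb : ∀ i' j → suc i' < j → ReachedAt (suc i') → ReachedAt j → ∀ d → V t (j + d) < n → ReachedAt (j + d)
    climb i' j lt ci cj zero _ = subst ReachedAt (sym (+-identityʳ j)) cj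
    climb i' j lt ci cj (suc d) vn = subst ReachedAt eq (subst Reached (head-up t tM i' (j + d) vn') fired)
      where
      eq : suc (j + d) ≡ j + suc d
      eq = sym (+-suc j d)
      vn' : V t (j + d) + M < n
      vn' = subst (_< n) (trans (cong (V t) (sym eq)) (V-suc t (j + d))) vn
      vd : V t (j + d) < n
      vd = <-trans (V-mono t (+-monoʳ-< j (n<1+n d))) vn
      fired : Reached (head (V t (suc i')) (V t (j + d)))
      fired = fireInClass (suc i') (j + d) (≤-trans lt (m≤m+n j d)) vd ci (climb i' j lt ci cj d vd)

    climbAll : ∀ i' j → suc i' < j → ReachedAt (suc i') → ReachedAt j → ∀ l → j ≤ l → V t l < n → ReachedAt l
    climbAll i' j lt ci cj l jl ln =
      subst ReachedAt e (climb i' j lt ci cj (l ∸ j) (subst (λ z → V t z < n) (sym e) ln))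
      where e : j + (l ∸ j) ≡ l
            e = m+[n∸m]≡n jl

    descendFromFirst : ∀ j → ReachedAt 0 → ReachedAt (suc j) → V t (suc j) < n → ∀ l → l ≤ suc j → ReachedAt l
    descendFromFirst zero c0 c1 _ zero _ = c0
    descendFromFirst zero c0 c1 _ (suc zero) _ = c1
    descendFromFirst zero c0 c1 _ (suc (suc l)) (s≤s ())
    descendFromFirst (suc j) c0 cj jn l le with l ≟ suc (suc j)
    ... | yes refl = cj
    ... | no ne = descendFromFirst j c0 cj' (<-trans (V-mono t (n<1+n (suc j))) jn) l (s≤s⁻¹ (≤∧≢⇒< le ne))
      where cj' : ReachedAt (suc j)
            cj' = subst Reached (head-first-far t tM j) (fireInClass 0 (suc (suc j)) (s≤s z≤n) jn c0 cj)

    descendToFirst : ∀ i L → ReachedAt i → ReachedAt L → V t L < n → n ≤ V t L + M → suc (suc i) ≤ L → ReachedAt 0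
    descendToFirst zero L ci cL Ln last le = ci
    descendToFirst (suc i) L ci cL Ln last le = descendToFirst i L ci' cL Ln last (≤-trans (n≤1+n _) le)
      where
      ne : L ≢ suc (suc i)
      ne e = <-irrefl (sym e) le
      ci' : ReachedAt i
      ci' = subst Reached (head-down t tM i L last ne) (fireInClass (suc i) L (≤-trans (n≤1+n _) le) Ln ci cL)

    findLastFrom : ∀ k j → V t j < n → n ≤ V t j + k → Σ ℕ λ L → j ≤ L × V t L < n × n ≤ V t L + M
    findLastFrom zero j jn h = ⊥-elim (<⇒≱ jn (subst (n ≤_) (+-identityʳ _) h))
    findLastFrom (suc k) j jn h with V t j + M <? n
    ... | no nl = j , ≤-refl , jn , ≮⇒≥ nl
    ... | yes yl with findLastFrom k (suc j) (subst (_< n) (sym (V-suc t j)) yl) h'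
      where h' : n ≤ V t (suc j) + k
            h' = ≤-trans h (≤-trans (≤-reflexive (+-suc (V t j) k)) (≤-trans (+-monoˡ-≤ k sx)
                   (≤-reflexive (cong (_+ k) (sym (V-suc t j))))))
              where sx : suc (V t j) ≤ V t j + M
                    sx = subst (_≤ V t j + M) (+-comm (V t j) 1) (+-monoʳ-≤ (V t j) (s≤s z≤n))
    ...   | L , jL , Ln , last = L , ≤-trans (n≤1+n j) jL , Ln , last

    findLast : ∀ j → V t j < n → Σ ℕ λ L → j ≤ L × V t L < n × n ≤ V t L + M
    findLast j jn = findLastFrom n j jn (m≤n+m n (V t j))

    ≤last : ∀ L l → n ≤ V t L + M → V t l < n → l ≤ L
    ≤last L l last ln = s≤s⁻¹ (V-cancel-< t (<-≤-trans ln (≤-trans last (≤-reflexive (sym (V-suc t L))))))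

    -- Successor heads carry the closure up to the last vertex of the class, predecessor heads then
    -- carry it down to the first, and from the first and the last every vertex is reached.
    pair⇒wholeClass : ∀ i j → i < j → V t j < n → ReachedAt i → ReachedAt j → ¬ (j ≡ suc i × n ≤ V t j + M) → ClassReached t
    pair⇒wholeClass zero (suc zero) lt jn ci cj nW l ln with n ≤? V t 1 + M
    ... | yes last = ⊥-elim (nW (refl , last))
    ... | no nl with l
    ...   | zero = ci
    ...   | suc zero = cj
    ...   | suc (suc l') = climbAll 0 2 ≤-refl cj c2 (suc (suc l')) (s≤s (s≤s z≤n)) ln
      where c2 : ReachedAt 2
            c2 = subst Reached (head-first-second t tM (≰⇒> nl)) (fireInClass 0 1 lt jn ci cj)
    pair⇒wholeClass zero (suc (suc j)) lt jn ci cj nW l ln with l ≤? suc (suc j)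
    ... | yes le = descendFromFirst (suc j) ci cj jn l le
    ... | no nle =
      climbAll 0 (suc (suc j)) (s≤s (s≤s z≤n)) (descendFromFirst (suc j) ci cj jn 1 (s≤s z≤n)) cj l (≰⇒≥ nle) ln
    pair⇒wholeClass (suc i) j lt jn ci cj nW l ln with findLast j jn
    ... | L , jL , Ln , last = descendFromFirst L' c0' cL'' Ln' l (subst (l ≤_) (sym eL') (≤last L l last ln))
      where
      cL : ReachedAt L
      cL = climbAll i j lt ci cj L jL Ln
      i2L : suc (suc (suc i)) ≤ L
      i2L with j ≟ L
      ... | yes refl with j ≟ suc (suc i)
      ...   | yes e = ⊥-elim (nW (e , last))
      ...   | no ne = ≤∧≢⇒< lt (ne ∘ sym)
      i2L | no ne = ≤-trans (s≤s lt) (≤∧≢⇒< jL ne)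
      c0' : ReachedAt 0
      c0' = descendToFirst (suc i) L ci cL Ln last i2L
      L' : ℕ
      L' = L ∸ 1
      eL' : suc L' ≡ L
      eL' = m+[n∸m]≡n {1} {L} (≤-trans (s≤s z≤n) i2L)
      cL'' : ReachedAt (suc L')
      cL'' = subst ReachedAt (sym eL') cL
      Ln' : V t (suc L') < n
      Ln' = subst (λ z → V t z < n) (sym eL') Ln

    firstTwo⇒wholeClass : V t 1 < n → ReachedAt 0 → ReachedAt 1 → ClassReached t
    firstTwo⇒wholeClass V1<n c0 c1 with n ≤? V t 1 + M
    ... | no nl = pair⇒wholeClass 0 1 (s≤s z≤n) V1<n c0 c1 (λ p → nl (proj₂ p))
    ... | yes last = λ l ln → descendFromFirst 0 c0 c1 V1<n l (≤last 1 l last ln)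

  suc%M%M : ∀ x → suc (x % M) % M ≡ suc x % M
  suc%M%M x = trans (%-distribˡ-+ 1 (x % M) M)
                    (trans (cong (λ z → (1 % M + z) % M) (m%n%n≡m%n x M)) (sym (%-distribˡ-+ 1 x M)))

  wrap-reached : ∀ t → t < M → ∀ i → V t (suc i) < n → n ≤ V t (suc i) + M →
                 Reached (V t i) → Reached (V t (suc i)) → Reached (suc t % M)
  wrap-reached t t<M i last<n last ri ri+1 =
    subst Reached (head-wrap t t<M i last) (InClass.fireInClass t t<M i (suc i) ≤-refl last<n ri ri+1)

  lastPair⇒nextClass : r ≢ 0 → ∀ t → t < M → ∀ i → V t (suc i) < n → n ≤ V t (suc i) + M →
                       Reached (V t i) → Reached (V t (suc i)) → ClassReached (suc t % M)
  lastPair⇒nextClass r≢0 t t<M i last<n last ri ri+1 =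
    InClass.firstTwo⇒wholeClass t' t'<M (V1<n t' t'<M) first second
    where
    t' : ℕ
    t' = suc t % M
    t'<M : t' < M
    t'<M = m%n<n (suc t) M
    reachedT' : Reached t'
    reachedT' = wrap-reached t t<M i last<n last ri ri+1
    first : Reached (V t' 0)
    first = subst Reached (sym (+-identityʳ t')) reachedT'
    second : Reached (V t' 1)
    second with wrapArc∈ r≢0 (V t (suc i)) last<n last
    ... | x , x∈ , ends =
      subst Reached (trans (cong (_+ M) (nextFirst-V t t<M (suc i))) (cong (t' +_) (sym (+-identityʳ M))))
            (fire x _ _ _ x∈ ends (subst Reached (sym (nextFirst-V t t<M (suc i))) reachedT') ri+1)

  class⇒nextClass : r ≢ 0 → ∀ t → t < M → ClassReached t → ClassReached (suc t % M)
  class⇒nextClass r≢0 t t<M reached with InClass.findLast t t<M 1 (V1<n t t<M)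
  ... | zero  , () , _
  ... | suc L , _ , last<n , last =
    lastPair⇒nextClass r≢0 t t<M L last<n last
                       (reached L (<-trans (V-mono t (n<1+n L)) last<n)) (reached (suc L) last<n)

  class⇒class+ : r ≢ 0 → ∀ t → t < M → ClassReached t → ∀ d → ClassReached ((t + d) % M)
  class⇒class+ r≢0 t t<M reached zero =
    subst ClassReached (sym (trans (cong (_% M) (+-identityʳ t)) (m<n⇒m%n≡m t<M))) reached
  class⇒class+ r≢0 t t<M reached (suc d) =
    subst ClassReached (trans (suc%M%M (t + d)) (cong (_% M) (sym (+-suc t d))))
          (class⇒nextClass r≢0 ((t + d) % M) (m%n<n (t + d) M) (class⇒class+ r≢0 t t<M reached d))

  class⇒all : ∀ t → t < M → ClassReached t → ∀ x → x < n → Reached x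
  class⇒all t t<M reached x x<n = byCases (r ≟ 0)
    where
    byCases : Dec (r ≡ 0) → Reached x
    byCases (yes r≡0) =
      subst Reached (sym (V-decompose x)) (subst ClassReached t≡s reached (x / M) (subst (_< n) (V-decompose x) x<n))
      where
      t≡s : t ≡ x % M
      t≡s = trans (n<1⇒n≡0 (subst (t <_) (cong suc r≡0) t<M))
                  (sym (n<1⇒n≡0 (subst (x % M <_) (cong suc r≡0) (m%n<n x M))))
    byCases (no r≢0) =
      subst Reached (sym (V-decompose x))
            (subst ClassReached t+d≡s (class⇒class+ r≢0 t t<M reached d) (x / M) (subst (_< n) (V-decompose x) x<n))
      where
      s d : ℕ
      s = x % M
      d = (M ∸ t) + s
      t+d≡s : (t + d) % M ≡ s
      t+d≡s = begin
        (t + ((M ∸ t) + s)) % M ≡⟨ cong (_% M) (sym (+-assoc t (M ∸ t) s)) ⟩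
        (t + (M ∸ t) + s) % M   ≡⟨ cong (λ z → (z + s) % M) (m+[n∸m]≡n (<⇒≤ t<M)) ⟩
        (M + s) % M             ≡⟨ cong (_% M) (+-comm M s) ⟩
        (s + M) % M             ≡⟨ [m+n]%n≡m%n s M ⟩
        s % M                   ≡⟨ m%n%n≡m%n x M ⟩
        s                       ∎
        where open ≡-Reasoning

  -- With a single class (M = 1) the wrap-around arc leads back to vertex 0 of the same class.
  pair⇒someClass : ∀ t → t < M → ∀ i j → i < j → V t j < n → Reached (V t i) → Reached (V t j) →
                   Σ ℕ λ s → s < M × ClassReached s
  pair⇒someClass t t<M i j i<j j<n ri rj with n ≤? V t j + M | j ≟ suc i
  ... | no notLast | _        = t , t<M , InClass.pair⇒wholeClass t t<M i j i<j j<n ri rj (notLast ∘ proj₂)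
  ... | yes _      | no j≢i+1 = t , t<M , InClass.pair⇒wholeClass t t<M i j i<j j<n ri rj (j≢i+1 ∘ proj₁)
  ... | yes last   | yes refl = byCases (r ≟ 0)
    where
    byCases : Dec (r ≡ 0) → Σ ℕ λ s → s < M × ClassReached s
    byCases (no r≢0)  = suc t % M , m%n<n (suc t) M , lastPair⇒nextClass r≢0 t t<M i j<n last ri rj
    byCases (yes r≡0) = t , t<M , InClass.pair⇒wholeClass t t<M 0 (suc i) (s≤s z≤n) j<n first rj notLastPair
      where
      M≡1 : M ≡ 1
      M≡1 = cong suc r≡0
      t≡0 : t ≡ 0
      t≡0 = n<1⇒n≡0 (subst (t <_) M≡1 t<M)
      first : Reached (V t 0)
      first = subst Reached (trans (%M≡0 M≡1 (suc t)) (sym (trans (+-identityʳ t) t≡0)))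
                    (wrap-reached t t<M i j<n last ri rj)
      notLastPair : ¬ (suc i ≡ suc 0 × n ≤ V t (suc i) + M)
      notLastPair (e , l) = M≡1⇒notLast M≡1 t t≡0 (subst (λ z → n ≤ V t z + M) e l)

  pair⇒all : ∀ a b → a < b → b < n → a % M ≡ b % M → Reached a → Reached b → ∀ x → x < n → Reached x
  pair⇒all a b a<b b<n sameClass ra rb with V-decompose-pair a b a<b sameClass
  ... | ea , eb , i<j
    with pair⇒someClass (b % M) (m%n<n b M) (a / M) (b / M) i<j (subst (_< n) eb b<n)
                        (subst Reached ea ra) (subst Reached eb rb)
  ...   | s , s<M , reached = class⇒all s s<M reached

  member⇒reached : ∀ y → lookup S y ≡ true → Reached (toℕ y)
  member⇒reached y Sy = y , refl , base (lookup⇒[]= y S Sy)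

  pair⇒closure : ∀ y₁ y₂ → toℕ y₁ < toℕ y₂ → lookup S y₁ ≡ true → lookup S y₂ ≡ true →
                 toℕ y₁ % M ≡ toℕ y₂ % M → ∀ x → InClosure constructed S x
  pair⇒closure y₁ y₂ y₁<y₂ Sy₁ Sy₂ sameClass x
    with pair⇒all (toℕ y₁) (toℕ y₂) y₁<y₂ (toℕ<n y₂) sameClass
                  (member⇒reached y₁ Sy₁) (member⇒reached y₂ Sy₂) (toℕ x) (toℕ<n x)
  ... | y , y≡x , closed = subst (InClosure constructed S) (toℕ-injective y≡x) closed

module Goodness (n r : ℕ) (M+M≤n : suc r + suc r ≤ n) (M+2≤n : suc (suc (suc r)) ≤ n) where
  open Layout n r M+M≤n M+2≤n
  open Construction n r M+M≤n M+2≤n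

  constructed-good : Good (suc M) constructed
  constructed-good S |S| x
    with pigeonhole (lookup S) M (λ y → toℕ y % M) (λ y → m%n<n (toℕ y) M) M<|S|
    where
    M<|S| : M < count (lookup S)
    M<|S| = ≤-reflexive (sym (trans (sym (∣tabulate∣≡count (lookup S)))
                                    (trans (cong ∣_∣ (tabulate∘lookup S)) |S|)))
  ... | y₁ , y₂ , y₁≢y₂ , Sy₁ , Sy₂ , sameClass with <-cmp (toℕ y₁) (toℕ y₂)
  ...   | tri< lt _ _ = ClosureOf.pair⇒closure n r M+M≤n M+2≤n S y₁ y₂ lt Sy₁ Sy₂ sameClass x
  ...   | tri≈ _ e _  = ⊥-elim (y₁≢y₂ (toℕ-injective e))
  ...   | tri> _ _ gt = ClosureOf.pair⇒closure n r M+M≤n M+2≤n S y₂ y₁ gt Sy₂ Sy₁ (sym sameClass) x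

upperBound : ∀ n r → suc r + suc r ≤ n → suc (suc (suc r)) ≤ n →
             Σ (Hypergraph n) λ H → Good (suc (suc r)) H × size H ≤ n C 2 ∸ turan n (suc r) + suc r
upperBound n r M+M≤n M+2≤n =
  constructed , constructed-good ,
  ≤-trans size-constructed (≤-reflexive (cong (_+ suc r) (sym (TuranCount.C2∸turan≡sumTo r n))))
  where
  open Construction n r M+M≤n M+2≤n
  open Goodness n r M+M≤n M+2≤n

2[r+2]≡[r+1]+[r+1]+2 : ∀ r → 2 * suc (suc r) ≡ (suc r + suc r) + 2
2[r+2]≡[r+1]+[r+1]+2 = solve-∀

theorem8p1 : ∀ (n k : ℕ) → 2 ≤ k → k + 1 ≤ n → 2 * k ≤ n + 2 →
  (∀ (H : Hypergraph n) → Good k H → (n C 2) ∸ turan n (k ∸ 1) ≤ size H)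
  × Σ (Hypergraph n) (λ H → Good k H × size H ≤ (n C 2) ∸ turan n (k ∸ 1) + (k ∸ 1))
theorem8p1 n (suc (suc r)) (s≤s (s≤s z≤n)) k+1≤n 2k≤n+2 = lowerBound n r M+2≤n , upperBound n r M+M≤n M+2≤n
  where
  M+2≤n : suc (suc (suc r)) ≤ n
  M+2≤n = subst (_≤ n) (+-comm (suc (suc r)) 1) k+1≤n
  M+M≤n : suc r + suc r ≤ n
  M+M≤n = +-cancelʳ-≤ 2 (suc r + suc r) n (subst (_≤ n + 2) (2[r+2]≡[r+1]+[r+1]+2 r) 2k≤n+2)
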